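{- Let $P$ be a set of partitions, $A$ a nonempty set of positive integers whose greatest common divisor is $1$, and $f:A\to\mathbb{N}$ a function such that $\operatorname{hk}_a(\lambda)<f(a)$ for all $\lambda\in P$ and $a\in A$. Then there is $M\in\mathbb{N}$ such that $\operatorname{hk}_1(\lambda)<M$ for all $\lambda\in P$.
   Context: For a partition $\lambda$ (weakly decreasing sequence of non-negative integers with finite sum) and a node $(a,b)$ of $\lambda$ (i.e. $b\le\lambda_a$), the $(a,b)$-hook is the set of nodes of $\lambda$ directly to the right of or directly below $(a,b)$, including $(a,b)$; its length is its number of nodes. For $a\ge1$, $\operatorname{hk}_a(\lambda)$ is the number of hooks of $\lambda$ of length $a$; in particular $\operatorname{hk}_1(\lambda)$ is the number of removable nodes of $\lambda$. -}

module Defs where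

open import Data.Nat using (ℕ; zero; suc; _+_; _∸_; _≤_; _<_; _≥_; _≟_; _<?_)
open import Data.Nat.GCD using (gcd)
open import Data.List using (List; []; _∷_; length; filter; upTo; sum; map; foldr; zip)
open import Data.List.Relation.Unary.All using (All)
open import Data.List.Relation.Unary.Linked using (Linked)
open import Data.Product using (_×_; _,_)

record Partition : Set where
  constructor mkPartition
  field
    parts      : List ℕ
    decreasing : Linked _≥_ parts
    positive   : All (0 <_) parts
open Partition public

colLen : List ℕ → ℕ → ℕ
colLen ps j = length (filter (j <?_) ps)

-- Hook length at the node in row i (0-indexed) of length r and column j
-- (0-indexed, j < r): arm + leg + 1 = (r ∸ j ∸ 1) + (λ'_j ∸ i ∸ 1) + 1.
hookLen : List ℕ → ℕ → ℕ → ℕ → ℕ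
hookLen ps i r j = (r ∸ j) + (colLen ps j ∸ i) ∸ 1

hooksInRow : List ℕ → ℕ → ℕ → ℕ → ℕ
hooksInRow ps a i r = length (filter (λ j → a ≟ hookLen ps i r j) (upTo r))


hk : ℕ → Partition → ℕ
hk a λ' = go 0 (parts λ')
  where
    go : ℕ → List ℕ → ℕ
    go i [] = 0
    go i (r ∷ rs) = hooksInRow (parts λ') a i r + go (suc i) rs

gcdList : List ℕ → ℕ
gcdList = foldr gcd 0

-- Put the k rows of the partition on a one-runner abacus: row i becomes a bead at
-- position β i = λᵢ + (k - 1 - i), the length of the hook at its first node. The
-- hooks in row i correspond to the gaps (empty positions) below β i, a hook of
-- length a to the gap β i - a; so hk a counts the a-slides: the gaps y with a bead
-- at y + a. Counting slides gives
--   hk (a + b) ≤ hk a + hk b   and   hk c ≤ hk (c + b) + hk b + b,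
-- so the set of a with hk a bounded on P contains 0 and is closed under addition
-- and subtraction, hence by Bézout under gcd, and therefore contains 1.

module Submission where

open import Defs
open import Data.Bool using (Bool; true; false; _∧_; _∨_; not)
open import Data.Bool.Properties using (∧-comm; ∧-inverseʳ; ∧-zeroʳ; ∨-identityʳ; ∨-zeroʳ)
open import Data.Empty using (⊥-elim)
open import Data.Nat
open import Data.Nat.GCD using (gcd; gcd-GCD; module Bézout)
open import Data.Nat.Properties
open import Algebra.Properties.CommutativeSemigroup +-commutativeSemigroup using (interchange)
open import Data.Nat.Tactic.RingSolver using (solve-∀)
open import Data.List using (List; []; _∷_; length; filter; upTo)
open import Data.List.Properties using (filter-all; filter-none; length-filter)
open import Data.List.Membership.Propositional using (_∈_)
open import Data.List.Membership.Propositional.Properties using (∈-filter⁺; ∈-filter⁻; ∈-upTo⁺; ∈-upTo⁻; ∈-length)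
open import Data.List.Relation.Unary.All using (All; []; _∷_)
open import Data.List.Relation.Unary.All.Properties using (applyUpTo⁺₁)
open import Data.List.Relation.Unary.Any using (here; there)
open import Data.List.Relation.Unary.Linked using (Linked; _∷_; tail)
open import Data.List.Relation.Unary.Unique.Propositional using (Unique; _∷_)
import Data.List.Relation.Unary.Unique.Propositional.Properties as Unique
open import Data.Product using (Σ; ∃; _×_; _,_; proj₁; proj₂)
open import Data.Sum using (inj₁; inj₂)
open import Function using (_∘_; id)
open import Relation.Binary using (tri<; tri≈; tri>)
open import Relation.Binary.PropositionalEquality
open import Relation.Nullary using (¬_; yes; no)
open import Relation.Nullary.Reflects using (Reflects; ofʸ; ofⁿ; fromEquivalence)
open import Relation.Unary using (Decidable)

Σ< : ℕ → (ℕ → ℕ) → ℕ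
Σ< zero    f = 0
Σ< (suc n) f = Σ< n f + f n

Σ<-cong : ∀ n {f g} → (∀ {x} → x < n → f x ≡ g x) → Σ< n f ≡ Σ< n g
Σ<-cong zero    f≡g = refl
Σ<-cong (suc n) f≡g = cong₂ _+_ (Σ<-cong n (f≡g ∘ m<n⇒m<1+n)) (f≡g (n<1+n n))

Σ<-zero : ∀ n {f} → (∀ {x} → x < n → f x ≡ 0) → Σ< n f ≡ 0
Σ<-zero n f≡0 = trans (Σ<-cong n f≡0) (Σ<-const-0 n)
  where
  Σ<-const-0 : ∀ n → Σ< n (λ _ → 0) ≡ 0
  Σ<-const-0 zero    = refl
  Σ<-const-0 (suc n) = cong (_+ 0) (Σ<-const-0 n)

Σ<-mono-≤ : ∀ n {f g} → (∀ x → f x ≤ g x) → Σ< n f ≤ Σ< n g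
Σ<-mono-≤ zero    f≤g = z≤n
Σ<-mono-≤ (suc n) f≤g = +-mono-≤ (Σ<-mono-≤ n f≤g) (f≤g n)

Σ<-+ : ∀ n f g → Σ< n (λ x → f x + g x) ≡ Σ< n f + Σ< n g
Σ<-+ zero    f g = refl
Σ<-+ (suc n) f g = trans (cong (_+ (f n + g n)) (Σ<-+ n f g)) (interchange (Σ< n f) (Σ< n g) (f n) (g n))

Σ<-split : ∀ m n f → Σ< (n + m) f ≡ Σ< m f + Σ< n (λ x → f (x + m))
Σ<-split m zero    f = sym (+-identityʳ (Σ< m f))
Σ<-split m (suc n) f = trans (cong (_+ f (n + m)) (Σ<-split m n f)) (+-assoc (Σ< m f) _ _)

Σ<-vanish : ∀ m n {f} → (∀ x → n ≤ x → f x ≡ 0) → Σ< (m + n) f ≡ Σ< n f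
Σ<-vanish m n {f} f≡0 = begin
  Σ< (m + n) f                              ≡⟨ Σ<-split n m f ⟩
  Σ< n f + Σ< m (λ x → f (x + n))           ≡⟨ cong (Σ< n f +_) (Σ<-zero m (λ {x} _ → f≡0 (x + n) (m≤n+m n x))) ⟩
  Σ< n f + 0                                ≡⟨ +-identityʳ (Σ< n f) ⟩
  Σ< n f                                    ∎
  where open ≡-Reasoning

Σ<-shift-≤ : ∀ n m {f} → (∀ x → n ≤ x → f x ≡ 0) → Σ< n (λ x → f (x + m)) ≤ Σ< n f
Σ<-shift-≤ n m {f} f≡0 = begin
  Σ< n (λ x → f (x + m))            ≤⟨ m≤n+m _ (Σ< m f) ⟩
  Σ< m f + Σ< n (λ x → f (x + m))   ≡⟨ Σ<-split m n f ⟨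
  Σ< (n + m) f                      ≡⟨ cong (λ l → Σ< l f) (+-comm n m) ⟩
  Σ< (m + n) f                      ≡⟨ Σ<-vanish m n f≡0 ⟩
  Σ< n f                            ∎
  where open ≤-Reasoning

Σ<-head : ∀ n f → Σ< (suc n) f ≡ f 0 + Σ< n (λ x → f (suc x))
Σ<-head zero    f = +-comm 0 (f 0)
Σ<-head (suc n) f = trans (cong (_+ f (suc n)) (Σ<-head n f)) (+-assoc (f 0) _ _)

true≢false : true ≢ false
true≢false ()

𝟙 : Bool → ℕ
𝟙 true  = 1
𝟙 false = 0

Σ<-𝟙-≤ : ∀ n P → Σ< n (𝟙 ∘ P) ≤ n
Σ<-𝟙-≤ zero    P = z≤n
Σ<-𝟙-≤ (suc n) P = ≤-trans (+-mono-≤ (Σ<-𝟙-≤ n P) (𝟙≤1 (P n))) (≤-reflexive (+-comm n 1))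
  where
  𝟙≤1 : ∀ b → 𝟙 b ≤ 1
  𝟙≤1 true  = ≤-refl
  𝟙≤1 false = z≤n

≡ᵇ-reflects : ∀ m n → Reflects (m ≡ n) (m ≡ᵇ n)
≡ᵇ-reflects m n = fromEquivalence (≡ᵇ⇒≡ m n) (≡⇒≡ᵇ m n)

inImage : (ℕ → ℕ) → ℕ → ℕ → Bool
inImage β zero    v = false
inImage β (suc k) v = inImage β k v ∨ (β k ≡ᵇ v)

inImage-∋ : ∀ β {k m} → m < k → inImage β k (β m) ≡ true
inImage-∋ β {suc k} {m} m<1+k with β k ≡ᵇ β m | ≡ᵇ-reflects (β k) (β m)
... | true  | _            = ∨-zeroʳ _
... | false | ofⁿ βk≢βm    = trans (∨-identityʳ _) (inImage-∋ β (≤∧≢⇒< (≤-pred m<1+k) (βk≢βm ∘ cong β ∘ sym)))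

inImage-∌ : ∀ β {k v} → (∀ {m} → m < k → β m ≢ v) → inImage β k v ≡ false
inImage-∌ β {zero}  β≢v = refl
inImage-∌ β {suc k} {v} β≢v with β k ≡ᵇ v | ≡ᵇ-reflects (β k) v
... | true  | ofʸ βk≡v = ⊥-elim (β≢v (n<1+n k) βk≡v)
... | false | _        = trans (∨-identityʳ _) (inImage-∌ β (β≢v ∘ m<n⇒m<1+n))

Σ<-single : ∀ {c N} (Q : ℕ → Bool) → c < N → Σ< N (λ x → 𝟙 ((c ≡ᵇ x) ∧ Q x)) ≡ 𝟙 (Q c)
Σ<-single {c} {suc N} Q c<1+N with c ≡ᵇ N | ≡ᵇ-reflects c N
... | true  | ofʸ refl = cong (_+ 𝟙 (Q c)) (Σ<-zero c only-c)
  where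
  only-c : ∀ {x} → x < c → 𝟙 ((c ≡ᵇ x) ∧ Q x) ≡ 0
  only-c {x} x<c with c ≡ᵇ x | ≡ᵇ-reflects c x
  ... | true  | ofʸ refl = ⊥-elim (<-irrefl refl x<c)
  ... | false | _        = refl
... | false | ofⁿ c≢N  = trans (+-identityʳ _) (Σ<-single Q (≤∧≢⇒< (≤-pred c<1+N) c≢N))

Σ<-image : ∀ β k N → (∀ {m n} → m < n → n < k → β m ≢ β n) → (∀ {m} → m < k → β m < N) →
           (Q : ℕ → Bool) → Σ< k (λ i → 𝟙 (Q (β i))) ≡ Σ< N (λ x → 𝟙 (inImage β k x ∧ Q x))
Σ<-image β zero    N injective below Q = sym (Σ<-zero N (λ _ → refl))
Σ<-image β (suc k) N injective below Q = begin
  Σ< k (λ i → 𝟙 (Q (β i))) + 𝟙 (Q (β k))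
    ≡⟨ cong₂ _+_ (Σ<-image β k N (λ m<n n<k → injective m<n (m<n⇒m<1+n n<k)) (below ∘ m<n⇒m<1+n) Q)
                 (sym (Σ<-single Q (below (n<1+n k)))) ⟩
  Σ< N (λ x → 𝟙 (inImage β k x ∧ Q x)) + Σ< N (λ x → 𝟙 ((β k ≡ᵇ x) ∧ Q x))
    ≡⟨ Σ<-+ N _ _ ⟨
  Σ< N (λ x → 𝟙 (inImage β k x ∧ Q x) + 𝟙 ((β k ≡ᵇ x) ∧ Q x))
    ≡⟨ Σ<-cong N (λ {x} _ → disjoint x) ⟩
  Σ< N (λ x → 𝟙 (inImage β (suc k) x ∧ Q x))
    ∎
  where
  open ≡-Reasoning
  disjoint : ∀ x → 𝟙 (inImage β k x ∧ Q x) + 𝟙 ((β k ≡ᵇ x) ∧ Q x) ≡ 𝟙 (inImage β (suc k) x ∧ Q x)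
  disjoint x with β k ≡ᵇ x | ≡ᵇ-reflects (β k) x
  ... | true  | ofʸ refl rewrite inImage-∌ β {k} {β k} (λ m<k → injective m<k (n<1+n k)) = refl
  ... | false | _        rewrite ∨-identityʳ (inImage β k x) = +-identityʳ _

module StrictlyIncreasing {f : ℕ → ℕ} (f-step : ∀ j → f j < f (suc j)) where

  mono : ∀ {j j'} → j < j' → f j < f j'
  mono {j} {suc j'} j<1+j' with m<1+n⇒m<n∨m≡n j<1+j'
  ... | inj₁ j<j' = <-trans (mono j<j') (f-step j')
  ... | inj₂ refl = f-step j

  injective : ∀ {j j'} → f j ≡ f j' → j ≡ j'
  injective {j} {j'} fj≡fj' with <-cmp j j'
  ... | tri< j<j' _ _ = ⊥-elim (<-irrefl fj≡fj' (mono j<j'))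
  ... | tri≈ _ j≡j' _ = j≡j'
  ... | tri> _ _ j'<j = ⊥-elim (<-irrefl (sym fj≡fj') (mono j'<j))

  floor : f 0 ≡ 0 → ∀ v → ∃ λ j → f j ≤ v × v < f (suc j)
  floor f0≡0 zero    = 0 , ≤-reflexive f0≡0 , subst (_< f 1) f0≡0 (f-step 0)
  floor f0≡0 (suc v) with floor f0≡0 v
  ... | j , fj≤v , v<f[1+j] with suc v <? f (suc j)
  ...   | yes 1+v<f[1+j] = j , m≤n⇒m≤1+n fj≤v , 1+v<f[1+j]
  ...   | no  1+v≮f[1+j] = suc j , ≤-reflexive (sym 1+v≡f[1+j]) , subst (_< f (suc (suc j))) (sym 1+v≡f[1+j]) (f-step (suc j))
    where
    1+v≡f[1+j] : suc v ≡ f (suc j)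
    1+v≡f[1+j] = ≤-antisym v<f[1+j] (≮⇒≥ 1+v≮f[1+j])

Unique-constant⇒length≤1 : ∀ {A : Set} {xs : List A} → Unique xs → (∀ {x y} → x ∈ xs → y ∈ xs → x ≡ y) → length xs ≤ 1
Unique-constant⇒length≤1 {xs = []}        _                   _     = z≤n
Unique-constant⇒length≤1 {xs = _ ∷ []}    _                   _     = ≤-refl
Unique-constant⇒length≤1 {xs = _ ∷ _ ∷ _} ((x≢y ∷ _) ∷ _) same = ⊥-elim (x≢y (same (here refl) (there (here refl))))

module _ {P : ℕ → Set} (P? : Decidable P) {r : ℕ} where

  length-filter-upTo≡0 : (∀ {j} → j < r → ¬ P j) → length (filter P? (upTo r)) ≡ 0
  length-filter-upTo≡0 ¬P = cong length (filter-none P? (applyUpTo⁺₁ id r ¬P))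

  length-filter-upTo≡1 : (∀ {j j'} → j < r → j' < r → P j → P j' → j ≡ j') →
                         ∀ {j} → j < r → P j → length (filter P? (upTo r)) ≡ 1
  length-filter-upTo≡1 unique j<r Pj =
    ≤-antisym (Unique-constant⇒length≤1 (Unique.filter⁺ P? (Unique.upTo⁺ r)) same) (∈-length (∈-filter⁺ P? (∈-upTo⁺ j<r) Pj))
    where
    same : ∀ {x y} → x ∈ filter P? (upTo r) → y ∈ filter P? (upTo r) → x ≡ y
    same x∈ y∈ with ∈-filter⁻ P? x∈ | ∈-filter⁻ P? y∈
    ... | x∈upTo , Px | y∈upTo , Py = unique (∈-upTo⁻ x∈upTo) (∈-upTo⁻ y∈upTo) Px Py

slide : (ℕ → Bool) → ℕ → ℕ → Bool
slide S a y = S (y + a) ∧ not (S y)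

slides : (ℕ → Bool) → ℕ → ℕ → ℕ
slides S a N = Σ< N (λ y → 𝟙 (slide S a y))

VanishesFrom : ℕ → (ℕ → Bool) → Set
VanishesFrom N S = ∀ x → N ≤ x → S x ≡ false

𝟙-∧-not-triangle : ∀ s t u → 𝟙 (s ∧ not t) ≤ 𝟙 (u ∧ not t) + 𝟙 (s ∧ not u)
𝟙-∧-not-triangle false t     u     = z≤n
𝟙-∧-not-triangle true  true  u     = z≤n
𝟙-∧-not-triangle true  false true  = ≤-refl
𝟙-∧-not-triangle true  false false = ≤-refl

𝟙-split : ∀ s u → 𝟙 s ≡ 𝟙 (s ∧ not u) + 𝟙 (u ∧ s)
𝟙-split false false = refl
𝟙-split false true  = refl
𝟙-split true  false = refl
𝟙-split true  true  = refl

slides-zero : ∀ S N → slides S 0 N ≡ 0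
slides-zero S N = Σ<-zero N (λ {y} _ → cong 𝟙 (trans (cong (λ z → S z ∧ not (S y)) (+-identityʳ y)) (∧-inverseʳ (S y))))

module _ {N : ℕ} {S : ℕ → Bool} (vanishes : VanishesFrom N S) where

  slide-vanishes : ∀ a y → N ≤ y → 𝟙 (slide S a y) ≡ 0
  slide-vanishes a y N≤y = cong (λ b → 𝟙 (b ∧ not (S y))) (vanishes (y + a) (≤-trans N≤y (m≤m+n y a)))

  slides-+-≤ : ∀ a b → slides S (a + b) N ≤ slides S a N + slides S b N
  slides-+-≤ a b = begin
    slides S (a + b) N
      ≤⟨ Σ<-mono-≤ N via-y+b ⟩
    Σ< N (λ y → 𝟙 (slide S b y) + 𝟙 (slide S a (y + b)))
      ≡⟨ Σ<-+ N _ _ ⟩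
    slides S b N + Σ< N (λ y → 𝟙 (slide S a (y + b)))
      ≤⟨ +-monoʳ-≤ (slides S b N) (Σ<-shift-≤ N b (slide-vanishes a)) ⟩
    slides S b N + slides S a N
      ≡⟨ +-comm (slides S b N) _ ⟩
    slides S a N + slides S b N ∎
    where
    open ≤-Reasoning
    -- If y + b is a bead, y is a b-slide; otherwise y + b is an a-slide.
    via-y+b : ∀ y → 𝟙 (slide S (a + b) y) ≤ 𝟙 (slide S b y) + 𝟙 (slide S a (y + b))
    via-y+b y rewrite +-comm a b | sym (+-assoc y b a) = 𝟙-∧-not-triangle (S (y + b + a)) (S y) (S (y + b))

  -- Count the beads twice: by whether a bead or a gap lies b above them, and by whether they lie
  -- below b, b above a gap, or b above a bead.
  bead-gap-pairs-≤ : ∀ b → Σ< N (λ x → 𝟙 (S x ∧ not (S (x + b)))) ≤ slides S b N + b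
  bead-gap-pairs-≤ b = +-cancelʳ-≤ (Σ< N G) _ _ (begin
    Σ< N F + Σ< N G             ≡⟨ Σ<-+ N F G ⟨
    Σ< N (λ x → F x + G x)      ≡⟨ Σ<-cong N (λ {x} _ → trans (𝟙-split (S x) (S (x + b))) (cong (λ s → F x + 𝟙 s) (∧-comm (S (x + b)) (S x)))) ⟨
    Σ< N (𝟙 ∘ S)                ≡⟨ Σ<-vanish b N (λ x N≤x → cong 𝟙 (vanishes x N≤x)) ⟨
    Σ< (b + N) (𝟙 ∘ S)          ≡⟨ cong (λ l → Σ< l (𝟙 ∘ S)) (+-comm b N) ⟩
    Σ< (N + b) (𝟙 ∘ S)          ≡⟨ Σ<-split b N (𝟙 ∘ S) ⟩
    Σ< b (𝟙 ∘ S) + Σ< N (λ y → 𝟙 (S (y + b)))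
      ≤⟨ +-mono-≤ (Σ<-𝟙-≤ b S) (≤-reflexive (Σ<-cong N (λ {y} _ → 𝟙-split (S (y + b)) (S y)))) ⟩
    b + Σ< N (λ y → 𝟙 (slide S b y) + G y)
      ≡⟨ cong (b +_) (Σ<-+ N _ G) ⟩
    b + (slides S b N + Σ< N G) ≡⟨ +-assoc b _ _ ⟨
    b + slides S b N + Σ< N G   ≡⟨ cong (_+ Σ< N G) (+-comm b _) ⟩
    slides S b N + b + Σ< N G   ∎)
    where
    open ≤-Reasoning
    F G : ℕ → ℕ
    F x = 𝟙 (S x ∧ not (S (x + b)))
    G x = 𝟙 (S x ∧ S (x + b))

  slides-cancel-≤ : ∀ c b → slides S c N ≤ slides S (c + b) N + slides S b N + b
  slides-cancel-≤ c b = begin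
    slides S c N
      ≤⟨ Σ<-mono-≤ N via-y+c+b ⟩
    Σ< N (λ y → 𝟙 (slide S (c + b) y) + F (y + c))
      ≡⟨ Σ<-+ N _ _ ⟩
    slides S (c + b) N + Σ< N (λ y → F (y + c))
      ≤⟨ +-monoʳ-≤ (slides S (c + b) N) (Σ<-shift-≤ N c F-vanishes) ⟩
    slides S (c + b) N + Σ< N F
      ≤⟨ +-monoʳ-≤ (slides S (c + b) N) (bead-gap-pairs-≤ b) ⟩
    slides S (c + b) N + (slides S b N + b)
      ≡⟨ +-assoc (slides S (c + b) N) _ _ ⟨
    slides S (c + b) N + slides S b N + b ∎
    where
    open ≤-Reasoning
    F : ℕ → ℕ
    F x = 𝟙 (S x ∧ not (S (x + b)))
    F-vanishes : ∀ x → N ≤ x → F x ≡ 0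
    F-vanishes x N≤x = cong (λ s → 𝟙 (s ∧ not (S (x + b)))) (vanishes x N≤x)
    -- If y + c + b is a bead, y is a (c + b)-slide; otherwise the bead y + c has a gap b above it.
    via-y+c+b : ∀ y → 𝟙 (slide S c y) ≤ 𝟙 (slide S (c + b) y) + F (y + c)
    via-y+c+b y rewrite sym (+-assoc y c b) = 𝟙-∧-not-triangle (S (y + c)) (S y) (S (y + c + b))

  slides-by-source : ∀ a → Σ< N (λ x → 𝟙 (S x ∧ ((a ≤ᵇ x) ∧ not (S (x ∸ a))))) ≡ slides S a N
  slides-by-source a = begin
    Σ< N h                               ≡⟨ Σ<-vanish a N h-vanishes ⟨
    Σ< (a + N) h                         ≡⟨ cong (λ l → Σ< l h) (+-comm a N) ⟩
    Σ< (N + a) h                         ≡⟨ Σ<-split a N h ⟩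
    Σ< a h + Σ< N (λ y → h (y + a))      ≡⟨ cong₂ _+_ (Σ<-zero a h-below) (Σ<-cong N (λ {y} _ → h-shifted y)) ⟩
    slides S a N                         ∎
    where
    open ≡-Reasoning
    h : ℕ → ℕ
    h x = 𝟙 (S x ∧ ((a ≤ᵇ x) ∧ not (S (x ∸ a))))
    h-vanishes : ∀ x → N ≤ x → h x ≡ 0
    h-vanishes x N≤x rewrite vanishes x N≤x = refl
    h-below : ∀ {x} → x < a → h x ≡ 0
    h-below {x} x<a with a ≤ᵇ x | ≤ᵇ-reflects-≤ a x
    ... | true  | ofʸ a≤x = ⊥-elim (<⇒≱ x<a a≤x)
    ... | false | _       = cong 𝟙 (∧-zeroʳ (S x))
    h-shifted : ∀ y → h (y + a) ≡ 𝟙 (slide S a y)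
    h-shifted y with a ≤ᵇ y + a | ≤ᵇ-reflects-≤ a (y + a)
    ... | true  | _         = cong (λ z → 𝟙 (S (y + a) ∧ not (S z))) (m+n∸n≡m y a)
    ... | false | ofⁿ a≰y+a = ⊥-elim (a≰y+a (m≤n+m a y))

suc+∸ : ∀ m n → suc m + n ∸ m ≡ suc n
suc+∸ m n = trans (cong (_∸ m) (sym (+-suc m n))) (m+n∸m≡n m (suc n))

hook-arith : ∀ {r j i l k} → j < r → i < l → l ≤ k →
             (r ∸ j) + (l ∸ i) ∸ 1 + (j + (k ∸ l)) ≡ r + (k ∸ suc i)
hook-arith {j = j} {i} j<r i<l l≤k
  with d , refl ← m≤n⇒∃[o]m+o≡n j<r
     | e , refl ← m≤n⇒∃[o]m+o≡n i<l
     | u , refl ← m≤n⇒∃[o]m+o≡n l≤k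
  rewrite suc+∸ j d | suc+∸ i e | m+n∸m≡n (suc i + e) u | +-assoc i e u | m+n∸m≡n i (e + u)
  = ring j d e u
  where
  ring : ∀ j d e u → d + suc e + (j + u) ≡ suc j + d + (e + u)
  ring = solve-∀

interval-arith : ∀ {a b k w} → a ≤ b → b ≤ k → k ∸ b ≤ w → w < k ∸ a →
                 ∃ λ m → a ≤ m × m < b × k ∸ suc m ≡ w
interval-arith {a} a≤b b≤k k∸b≤w w<k∸a
  with d , refl ← m≤n⇒∃[o]m+o≡n a≤b
     | u , refl ← m≤n⇒∃[o]m+o≡n b≤k
  rewrite m+n∸m≡n (a + d) u | +-assoc a d u | m+n∸m≡n a (d + u)
  with e , refl ← m≤n⇒∃[o]m+o≡n k∸b≤w
  with f , refl ← m≤n⇒∃[o]m+o≡n (+-cancelˡ-< u e d (subst (u + e <_) (+-comm d u) w<k∸a))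
  = a + f , m≤m+n a f , +-monoʳ-< a (s≤s (m≤n+m f e)) , value
  where
  shuffle : ∀ a e f u → a + (suc e + f + u) ≡ suc (a + f) + (u + e)
  shuffle = solve-∀
  value : a + (suc e + f + u) ∸ suc (a + f) ≡ u + e
  value rewrite shuffle a e f u = m+n∸m≡n (suc (a + f)) (u + e)

row : List ℕ → ℕ → ℕ
row []       i       = 0
row (x ∷ xs) zero    = x
row (x ∷ xs) (suc i) = row xs i

row-≤-head : ∀ {x xs i} → Linked _≥_ (x ∷ xs) → row xs i ≤ x
row-≤-head {xs = []}                 _           = z≤n
row-≤-head {xs = y ∷ ys} {i = zero}  (x≥y ∷ _)   = x≥y
row-≤-head {xs = y ∷ ys} {i = suc i} (x≥y ∷ ys↘) = ≤-trans (row-≤-head ys↘) x≥y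

row-antitone : ∀ {xs i i'} → Linked _≥_ xs → i ≤ i' → row xs i' ≤ row xs i
row-antitone {[]}                    _   _         = z≤n
row-antitone {x ∷ xs} {i' = zero}    _   z≤n       = ≤-refl
row-antitone {x ∷ xs} {i' = suc i'}  xs↘ z≤n       = row-≤-head xs↘
row-antitone {x ∷ xs}                xs↘ (s≤s i≤i') = row-antitone (tail xs↘) i≤i'

<colLen⇒<row : ∀ {xs m j} → Linked _≥_ xs → m < colLen xs j → j < row xs m
<colLen⇒<row {x ∷ xs} {m} {j} xs↘ m<L with j <ᵇ x | <ᵇ-reflects-< j x
<colLen⇒<row {x ∷ xs} {zero}  xs↘ m<L       | true  | ofʸ j<x = j<x
<colLen⇒<row {x ∷ xs} {suc m} xs↘ (s≤s m<L) | true  | ofʸ j<x = <colLen⇒<row (tail xs↘) m<L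
... | false | ofⁿ j≮x = ⊥-elim (j≮x (<-≤-trans (<colLen⇒<row (tail xs↘) m<L) (row-≤-head xs↘)))

<row⇒<colLen : ∀ {xs m j} → Linked _≥_ xs → j < row xs m → m < colLen xs j
<row⇒<colLen {x ∷ xs} {m} {j} xs↘ j<row with j <ᵇ x | <ᵇ-reflects-< j x
<row⇒<colLen {x ∷ xs} {zero}  xs↘ j<row | true  | _       = s≤s z≤n
<row⇒<colLen {x ∷ xs} {suc m} xs↘ j<row | true  | _       = s≤s (<row⇒<colLen (tail xs↘) j<row)
<row⇒<colLen {x ∷ xs} {zero}  xs↘ j<x   | false | ofⁿ j≮x = ⊥-elim (j≮x j<x)
<row⇒<colLen {x ∷ xs} {suc m} xs↘ j<row | false | ofⁿ j≮x = ⊥-elim (j≮x (<-≤-trans j<row (row-≤-head xs↘)))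

module Abacus (p : Partition) where

  k : ℕ
  k = length (parts p)

  -- ℓ and L are the row and column lengths. φ j = j + #{rows of length ≤ j} enumerates the
  -- gaps, and the hook at (i, j) has length β i ∸ φ j.
  ℓ L β φ : ℕ → ℕ
  ℓ = row (parts p)
  L = colLen (parts p)
  β i = ℓ i + (k ∸ suc i)
  φ j = j + (k ∸ L j)

  isβ : ℕ → Bool
  isβ = inImage β k

  N : ℕ
  N = ℓ 0 + k

  private
    ↘ = decreasing p

  L≤k : ∀ j → L j ≤ k
  L≤k j = length-filter (j <?_) (parts p)

  L0≡k : L 0 ≡ k
  L0≡k = cong length (filter-all (0 <?_) (positive p))

  L-antitone : ∀ j → L (suc j) ≤ L j
  L-antitone j = ≮⇒≥ λ Lj<L[1+j] →
    <-irrefl refl (<row⇒<colLen ↘ (<-trans (n<1+n j) (<colLen⇒<row ↘ Lj<L[1+j])))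

  β-decreasing : ∀ {m n} → m < n → n < k → β n < β m
  β-decreasing m<n n<k = +-mono-≤-< (row-antitone ↘ (<⇒≤ m<n)) (∸-monoʳ-< (s≤s m<n) n<k)

  β<N : ∀ {m} → m < k → β m < N
  β<N m<k = +-mono-≤-< (row-antitone ↘ z≤n) (∸-monoʳ-< (s≤s z≤n) m<k)

  isβ-vanishes : VanishesFrom N isβ
  isβ-vanishes x N≤x = inImage-∌ β λ m<k βm≡x → <⇒≱ (β<N m<k) (subst (N ≤_) (sym βm≡x) N≤x)

  φ-step : ∀ j → φ j < φ (suc j)
  φ-step j = +-mono-<-≤ (n<1+n j) (∸-monoʳ-≤ k (L-antitone j))

  φ0≡0 : φ 0 ≡ 0
  φ0≡0 = trans (cong (k ∸_) L0≡k) (n∸n≡0 k)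

  φ-not-β : ∀ j → isβ (φ j) ≡ false
  φ-not-β j = inImage-∌ β βm≢φj
    where
    βm≢φj : ∀ {m} → m < k → β m ≢ φ j
    βm≢φj {m} m<k with m <? L j
    ... | yes m<Lj = <⇒≢ (+-mono-≤ (<colLen⇒<row ↘ m<Lj) (∸-monoʳ-≤ k m<Lj)) ∘ sym
    ... | no  m≮Lj = <⇒≢ (+-mono-≤-< ℓm≤j (∸-monoʳ-< (s≤s (≮⇒≥ m≮Lj)) m<k))
      where
      ℓm≤j : ℓ m ≤ j
      ℓm≤j = ≮⇒≥ (m≮Lj ∘ <row⇒<colLen ↘)

  -- The rows m with L (suc j) ≤ m < L j have length suc j, and their beads fill the positions
  -- strictly between φ j and φ (suc j).
  between-φ⇒β : ∀ {j v} → φ j < v → v < φ (suc j) → isβ v ≡ true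
  between-φ⇒β {j} φj<v v<φ[1+j]
    with w , refl ← m≤n⇒∃[o]m+o≡n (≤-<-trans (m≤m+n j _) φj<v)
    with interval-arith (L-antitone j) (L≤k j) (+-cancelˡ-≤ j _ _ (≤-pred φj<v)) (+-cancelˡ-< (suc j) w _ v<φ[1+j])
  ... | m , L[1+j]≤m , m<Lj , k∸[1+m]≡w =
    subst (λ v → isβ v ≡ true) (cong₂ _+_ ℓm≡1+j k∸[1+m]≡w) (inImage-∋ β (<-≤-trans m<Lj (L≤k j)))
    where
    ℓm≡1+j : ℓ m ≡ suc j
    ℓm≡1+j = ≤-antisym (≮⇒≥ λ 1+j<ℓm → <⇒≱ (<row⇒<colLen ↘ 1+j<ℓm) L[1+j]≤m) (<colLen⇒<row ↘ m<Lj)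

  non-β⇒φ : ∀ {v} → isβ v ≡ false → ∃ λ j → φ j ≡ v
  non-β⇒φ {v} v∉β with StrictlyIncreasing.floor φ-step φ0≡0 v
  ... | j , φj≤v , v<φ[1+j] = j , ≤∧≮⇒≡ φj≤v λ φj<v →
    true≢false (trans (sym (between-φ⇒β φj<v v<φ[1+j])) v∉β)

  φ<β⇒<ℓ : ∀ {i j} → i < k → φ j < β i → j < ℓ i
  φ<β⇒<ℓ {i} {j} i<k φj<βi = ≰⇒> λ ℓi≤j →
    <-asym φj<βi (+-mono-≤-< ℓi≤j (∸-monoʳ-< (s≤s (Lj≤i ℓi≤j)) i<k))
    where
    Lj≤i : ℓ i ≤ j → L j ≤ i
    Lj≤i ℓi≤j = ≮⇒≥ λ i<Lj → <⇒≱ (<colLen⇒<row ↘ i<Lj) ℓi≤j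

  hook+φ≡β : ∀ {i j} → j < ℓ i → hookLen (parts p) i (ℓ i) j + φ j ≡ β i
  hook+φ≡β j<ℓi = hook-arith j<ℓi (<row⇒<colLen ↘ j<ℓi) (L≤k _)

  module Row {i : ℕ} (a : ℕ) where

    H : ℕ → ℕ
    H = hookLen (parts p) i (ℓ i)

    hook⇒gap : ∀ {j} → j < ℓ i → a ≡ H j → a ≤ β i × β i ∸ a ≡ φ j
    hook⇒gap {j} j<ℓi a≡Hj = subst (a ≤_) a+φj≡βi (m≤m+n a (φ j)) , trans (cong (_∸ a) (sym a+φj≡βi)) (m+n∸m≡n a (φ j))
      where
      a+φj≡βi : a + φ j ≡ β i
      a+φj≡βi = trans (cong (_+ φ j) a≡Hj) (hook+φ≡β j<ℓi)

    gap⇒hook : ∀ {j} → j < ℓ i → a ≤ β i → φ j ≡ β i ∸ a → a ≡ H j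
    gap⇒hook {j} j<ℓi a≤βi φj≡βi∸a = +-cancelʳ-≡ (φ j) a (H j) (begin
      a + φ j         ≡⟨ cong (a +_) φj≡βi∸a ⟩
      a + (β i ∸ a)   ≡⟨ m+[n∸m]≡n a≤βi ⟩
      β i             ≡⟨ hook+φ≡β j<ℓi ⟨
      H j + φ j       ∎)
      where open ≡-Reasoning

    β∸a<β : i < k → isβ (β i ∸ a) ≡ false → β i ∸ a < β i
    β∸a<β i<k β∸a∉β = ≤∧≢⇒< (m∸n≤m (β i) a) λ β∸a≡β →
      true≢false (trans (sym (inImage-∋ β i<k)) (trans (cong isβ (sym β∸a≡β)) β∸a∉β))

    unique : ∀ {j j'} → j < ℓ i → j' < ℓ i → a ≡ H j → a ≡ H j' → j ≡ j'
    unique j<ℓi j'<ℓi a≡Hj a≡Hj' =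
      StrictlyIncreasing.injective φ-step (trans (sym (proj₂ (hook⇒gap j<ℓi a≡Hj))) (proj₂ (hook⇒gap j'<ℓi a≡Hj')))

    hooksInRow≡ : i < k → hooksInRow (parts p) a i (ℓ i) ≡ 𝟙 ((a ≤ᵇ β i) ∧ not (isβ (β i ∸ a)))
    hooksInRow≡ i<k with a ≤ᵇ β i | ≤ᵇ-reflects-≤ a (β i) | isβ (β i ∸ a) in β∸a?
    ... | false | ofⁿ a≰βi | _     = length-filter-upTo≡0 (λ j → a ≟ H j) λ j<ℓi a≡Hj →
      a≰βi (proj₁ (hook⇒gap j<ℓi a≡Hj))
    ... | true  | _        | true  = length-filter-upTo≡0 (λ j → a ≟ H j) λ j<ℓi a≡Hj →
      true≢false (trans (sym β∸a?) (subst (λ v → isβ v ≡ false) (sym (proj₂ (hook⇒gap j<ℓi a≡Hj))) (φ-not-β _)))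
    ... | true  | ofʸ a≤βi | false with non-β⇒φ β∸a?
    ...   | j , φj≡β∸a = length-filter-upTo≡1 (λ j → a ≟ H j) unique j<ℓi (gap⇒hook j<ℓi a≤βi φj≡β∸a)
      where
      j<ℓi : j < ℓ i
      j<ℓi = φ<β⇒<ℓ i<k (subst (_< β i) (sym φj≡β∸a) (β∸a<β i<k β∸a?))

  hk≡Σ-hooksInRow : ∀ a → hk a p ≡ Σ< k (λ i → hooksInRow (parts p) a i (ℓ i))
  hk≡Σ-hooksInRow a = trans (sym go-hk) (go≡Σ 0 (parts p))
    where
    F : ℕ → ℕ → ℕ
    F = hooksInRow (parts p) a
    -- The row recursion of hk is local to Defs; the with-abstraction in go-hk solves this meta to it.
    go : ℕ → List ℕ → ℕ
    go = _
    go-hk : go 0 (parts p) ≡ hk a p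
    go-hk with 0 | parts p
    ... | _ | _ = refl
    go≡Σ : ∀ i rs → go i rs ≡ Σ< (length rs) (λ m → F (i + m) (row rs m))
    go≡Σ i []       = refl
    go≡Σ i (r ∷ rs) = begin
      F i r + go (suc i) rs
        ≡⟨ cong₂ _+_ (cong (λ i → F i r) (sym (+-identityʳ i)))
                     (trans (go≡Σ (suc i) rs) (Σ<-cong (length rs) λ {m} _ → cong (λ i → F i (row rs m)) (sym (+-suc i m)))) ⟩
      F (i + 0) r + Σ< (length rs) (λ m → F (i + suc m) (row rs m))
        ≡⟨ Σ<-head (length rs) (λ m → F (i + m) (row (r ∷ rs) m)) ⟨
      Σ< (length (r ∷ rs)) (λ m → F (i + m) (row (r ∷ rs) m))
        ∎
      where open ≡-Reasoning

  hk≡slides : ∀ a → hk a p ≡ slides isβ a N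
  hk≡slides a = begin
    hk a p                                               ≡⟨ hk≡Σ-hooksInRow a ⟩
    Σ< k (λ i → hooksInRow (parts p) a i (ℓ i))          ≡⟨ Σ<-cong k (Row.hooksInRow≡ a) ⟩
    Σ< k (λ i → 𝟙 (Q (β i)))                             ≡⟨ Σ<-image β k N β-injective β<N Q ⟩
    Σ< N (λ x → 𝟙 (isβ x ∧ Q x))                         ≡⟨ slides-by-source isβ-vanishes a ⟩
    slides isβ a N                                       ∎
    where
    open ≡-Reasoning
    Q : ℕ → Bool
    Q x = (a ≤ᵇ x) ∧ not (isβ (x ∸ a))
    β-injective : ∀ {m n} → m < n → n < k → β m ≢ β n
    β-injective m<n n<k = <⇒≢ (β-decreasing m<n n<k) ∘ sym

module _ (p : Partition) where

  open Abacus p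

  hk-zero : hk 0 p ≡ 0
  hk-zero = trans (hk≡slides 0) (slides-zero isβ N)

  hk-+-≤ : ∀ a b → hk (a + b) p ≤ hk a p + hk b p
  hk-+-≤ a b = begin
    hk (a + b) p                        ≡⟨ hk≡slides (a + b) ⟩
    slides isβ (a + b) N                ≤⟨ slides-+-≤ isβ-vanishes a b ⟩
    slides isβ a N + slides isβ b N     ≡⟨ cong₂ _+_ (hk≡slides a) (hk≡slides b) ⟨
    hk a p + hk b p                     ∎
    where open ≤-Reasoning

  hk-cancel-≤ : ∀ c b → hk c p ≤ hk (c + b) p + hk b p + b
  hk-cancel-≤ c b = begin
    hk c p                                                ≡⟨ hk≡slides c ⟩
    slides isβ c N                                        ≤⟨ slides-cancel-≤ isβ-vanishes c b ⟩
    slides isβ (c + b) N + slides isβ b N + b             ≡⟨ cong (_+ b) (cong₂ _+_ (hk≡slides (c + b)) (hk≡slides b)) ⟨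
    hk (c + b) p + hk b p + b                             ∎
    where open ≤-Reasoning

module Bounded (P : Partition → Set) where

  BoundedHk : ℕ → Set
  BoundedHk a = ∃ λ M → ∀ p → P p → hk a p ≤ M

  bounded-0 : BoundedHk 0
  bounded-0 = 0 , λ p _ → ≤-reflexive (hk-zero p)

  bounded-+ : ∀ {a b} → BoundedHk a → BoundedHk b → BoundedHk (a + b)
  bounded-+ {a} {b} (M , hk≤M) (M' , hk≤M') =
    M + M' , λ p Pp → ≤-trans (hk-+-≤ p a b) (+-mono-≤ (hk≤M p Pp) (hk≤M' p Pp))

  bounded-cancel : ∀ {c b} → BoundedHk (c + b) → BoundedHk b → BoundedHk c
  bounded-cancel {c} {b} (M , hk≤M) (M' , hk≤M') =
    M + M' + b , λ p Pp → ≤-trans (hk-cancel-≤ p c b) (+-monoˡ-≤ b (+-mono-≤ (hk≤M p Pp) (hk≤M' p Pp)))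

  bounded-* : ∀ {m} → BoundedHk m → ∀ x → BoundedHk (x * m)
  bounded-* bm zero    = bounded-0
  bounded-* bm (suc x) = bounded-+ bm (bounded-* bm x)

  bounded-gcd : ∀ {m n} → BoundedHk m → BoundedHk n → BoundedHk (gcd m n)
  bounded-gcd {m} {n} bm bn with Bézout.identity (gcd-GCD m n)
  ... | Bézout.+- x y eq = bounded-cancel (subst BoundedHk (sym eq) (bounded-* bm x)) (bounded-* bn y)
  ... | Bézout.-+ x y eq = bounded-cancel (subst BoundedHk (sym eq) (bounded-* bn y)) (bounded-* bm x)

  bounded-gcdList : ∀ {A : ℕ → Set} → (∀ {a} → A a → BoundedHk a) → ∀ {xs} → All A xs → BoundedHk (gcdList xs)
  bounded-gcdList bounded []         = bounded-0
  bounded-gcdList bounded (Ax ∷ Axs) = bounded-gcd (bounded Ax) (bounded-gcdList bounded Axs)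

open Bounded

proposition3p10 : (P : Partition → Set) (A : ℕ → Set)
    → (∃ λ a → A a)
    → (∀ a → A a → 0 < a)
    → (Σ (List ℕ) λ xs → All A xs × gcdList xs ≡ 1)
    → (f : (a : ℕ) → A a → ℕ)
    → (∀ p → P p → ∀ a → (h : A a) → hk a p < f a h)
    → ∃ λ M → ∀ p → P p → hk 1 p < M
proposition3p10 P A _ _ (xs , Axs , gcd≡1) f hk<f = suc (proj₁ bounded-1) , λ p Pp → s≤s (proj₂ bounded-1 p Pp)
  where
  bounded-A : ∀ {a} → A a → BoundedHk P a
  bounded-A {a} Aa = f a Aa , λ p Pp → <⇒≤ (hk<f p Pp a Aa)
  bounded-1 : BoundedHk P 1
  bounded-1 = subst (BoundedHk P) gcd≡1 (bounded-gcdList P bounded-A Axs)
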